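{- Let $k\ge3$ and let $q\equiv1\pmod{k(k-1)}$ be a prime power. If there exists a $(q,k,1)$ Banff set in $\mathbb F_q$, then there exists a Banff $(q,k,1)$ difference family in the additive group of $\mathbb F_q$.
   Context: For $e$ dividing $q-1$, $C^e$ denotes the subgroup of index $e$ of $\mathbb F_q^*$ (the nonzero $e$-th powers). With $e=k(k-1)/2$, a $k$-subset $B=\{b_0,\dots,b_{k-1}\}$ of $\mathbb F_q$ is a $(q,k,1)$ Banff set if (1) the list $\{b_i-b_j: 0\le i<j\le k-1\}$ is a complete system of representatives for the cosets of $C^{e}$ in $\mathbb F_q^*$, and (2) $B$ is a partial system of representatives for the cosets of $C^{e}$ in $\mathbb F_q^*$ (its elements are nonzero and lie in pairwise distinct cosets). A $(v,k,\lambda)$ difference family in an additive group $G$ of order $v$ is a set $\mathcal F$ of $k$-subsets of $G$ such that the list $\{x-y: x,y\in B, x\ne y, B\in\mathcal F\}$ contains every nonzero element of $G$ exactly $\lambda$ times. A Banff difference family is a difference family $\{B_1,\dots,B_n\}$ with pairwise disjoint base blocks, $0\notin B_i$ for all $i$, and $B_i\cap -B_j=\emptyset$ for every pair $(i,j)$ (including $i=j$). -}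

module Defs where

open import Level using (0ℓ)
open import Data.Nat as ℕ using (ℕ; zero; suc; _∸_)
open import Data.Nat.Primality using (Prime)
open import Data.Fin using (Fin) renaming (_<_ to _<ᶠ_)
open import Data.Product using (Σ; ∃; _×_; _,_)
open import Function.Bundles using (_↔_)
open import Relation.Binary.PropositionalEquality using (_≡_; _≢_)
open import Algebra.Structures using (IsCommutativeRing)

IsPrimePower : ℕ → Set
IsPrimePower q = Σ ℕ λ p → Σ ℕ λ n → Prime p × (1 ℕ.≤ n) × (q ≡ p ℕ.^ n)

record FiniteField (q : ℕ) : Set₁ where
  infixl 6 _+_ _-_
  infixl 7 _*_
  field
    Carrier : Set
    _+_ _*_ : Carrier → Carrier → Carrier
    -_      : Carrier → Carrier
    0# 1#   : Carrier
    isCommutativeRing : IsCommutativeRing _≡_ _+_ _*_ -_ 0# 1#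
    0≢1     : 0# ≢ 1#
    inverse : ∀ x → x ≢ 0# → Σ Carrier λ y → x * y ≡ 1#
    enumeration : Carrier ↔ Fin q

  _-_ : Carrier → Carrier → Carrier
  x - y = x + (- y)

  _^_ : Carrier → ℕ → Carrier
  x ^ zero  = 1#
  x ^ suc n = x * (x ^ n)

  -- x and y (nonzero) lie in the same coset of C^e = {z^e : z ≠ 0}
  SameCoset : ℕ → Carrier → Carrier → Set
  SameCoset e x y = Σ Carrier λ z → (z ≢ 0#) × (x ≡ y * (z ^ e))

halfPairs : ℕ → ℕ
halfPairs k = (k ℕ.* (k ∸ 1)) ℕ./ 2

module _ {q : ℕ} (F : FiniteField q) where
  open FiniteField F

  -- A k-subset of F_q, given as an injective enumeration Fin k → F_q
  InjectiveBlock : (k : ℕ) → (Fin k → Carrier) → Set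
  InjectiveBlock k b = ∀ i j → b i ≡ b j → i ≡ j

  IsBanffSet : (k : ℕ) → (Fin k → Carrier) → Set
  IsBanffSet k b =
    InjectiveBlock k b
    -- (1) {b_i - b_j : i < j} is a complete system of representatives of F_q^*/C^e
    × (∀ i j → i <ᶠ j → b i - b j ≢ 0#)
    × (∀ x → x ≢ 0# → Σ (Fin k) λ i → Σ (Fin k) λ j → (i <ᶠ j) × SameCoset (halfPairs k) (b i - b j) x)
    × (∀ i j i′ j′ → i <ᶠ j → i′ <ᶠ j′ →
         SameCoset (halfPairs k) (b i - b j) (b i′ - b j′) → (i ≡ i′) × (j ≡ j′))
    -- (2) B is a partial system of representatives
    × (∀ i → b i ≢ 0#)
    × (∀ i j → SameCoset (halfPairs k) (b i) (b j) → i ≡ j)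

  IsDifferenceFamily₁ : (k n : ℕ) → (Fin n → Fin k → Carrier) → Set
  IsDifferenceFamily₁ k n B =
    (∀ t → InjectiveBlock k (B t))
    × (∀ g → g ≢ 0# → Σ (Fin n) λ t → Σ (Fin k) λ i → Σ (Fin k) λ j → (i ≢ j) × (g ≡ B t i - B t j))
    × (∀ t i j t′ i′ j′ → i ≢ j → i′ ≢ j′ → B t i - B t j ≡ B t′ i′ - B t′ j′ →
         (t ≡ t′) × (i ≡ i′) × (j ≡ j′))

  IsBanffDifferenceFamily : (k n : ℕ) → (Fin n → Fin k → Carrier) → Set
  IsBanffDifferenceFamily k n B =
    IsDifferenceFamily₁ k n B
    × (∀ t t′ i j → t ≢ t′ → B t i ≢ B t′ j)
    × (∀ t i → B t i ≢ 0#)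
    × (∀ t t′ i j → B t i ≢ - (B t′ j))

{-# OPTIONS --safe #-}
-- Let H = C^e.  Since the differences b_i - b_j (i < j) represent every coset of H exactly once,
-- F_q^* is in bijection with {(i, j) : i < j} × H; with k(k-1) ∣ q - 1 this makes |H| even.  Inversion
-- on H then has a fixed point other than 1, which can only be -1, so -1 ∈ H and -1 ≠ 1.  Let S be
-- a set of representatives of H/{±1}.  The blocks s·B (s ∈ S) form the family: a nonzero g is
-- h (b_i - b_j) for unique h ∈ H and i < j, and writing h = ±s turns this into a difference inside
-- exactly one block.  The Banff conditions hold because B is a partial system of representatives.
module Submission where

open import Defs
open import Level using (0ℓ)
open import Algebra.Bundles using (CommutativeRing)
open import Data.Bool.Properties using (T-irrelevant)
open import Data.Fin.Base using (Fin; zero; suc) renaming (_<_ to _<ᶠ_)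
open import Data.Fin.Properties
  using (0↔⊥; 1↔⊤; +↔⊎; *↔×; any?; <-cmp; _<?_; <⇒≢; nonZeroIndex) renaming (_≟_ to _≟ᶠ_)
open import Data.Fin.Permutation using (↔⇒≡)
open import Data.Nat.Base as ℕ using (ℕ; zero; suc; _∸_; _≤_; s≤s; z≤n)
open import Data.Nat.Divisibility using (_∣_; divides; ∣m+n∣m⇒∣n; ∣1⇒≡1; *-cancelˡ-∣)
import Data.Nat.Properties as ℕₚ
open import Data.Product.Base using (Σ; ∃; _×_; _,_; proj₁; proj₂)
open import Data.Product.Function.Dependent.Propositional using (Σ-↔)
open import Data.Product.Function.NonDependent.Propositional using (_×-↔_)
open import Data.Sum.Base using (_⊎_; inj₁; inj₂)
open import Data.Sum.Function.Propositional using (_⊎-↔_)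
open import Data.Unit.Base using (⊤; tt)
open import Function.Base using (_∘_)
open import Function.Bundles using (_↔_; Inverse; Injection; mk↔ₛ′)
open import Function.Properties.Inverse using (↔-refl; ↔-sym; ↔-trans; ↔⇒↣)
open import Relation.Binary.Definitions using (Tri; tri<; tri≈; tri>; DecidableEquality)
open import Relation.Binary.PropositionalEquality
open import Relation.Nullary.Decidable
  using (Dec; yes; no; True; toWitness; fromWitness; map′; via-injection; ¬?; _×-dec_; decidable-stable)
open import Relation.Nullary.Negation using (¬_; contradiction)
open import Relation.Unary using (Pred; Decidable)

Finite : Set → Set
Finite A = ∃ λ n → A ↔ Fin n

Subtype : {A : Set} {P : Pred A 0ℓ} → Decidable P → Set
Subtype {A} P? = Σ A (λ x → True (P? x))

Subtype-≡ : {A : Set} {P : Pred A 0ℓ} {P? : Decidable P} {u v : Subtype P?} → proj₁ u ≡ proj₁ v → u ≡ v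
Subtype-≡ {u = x , s} {v = .x , t} refl = cong (x ,_) (T-irrelevant s t)

↔-finite : {A B : Set} → A ↔ B → Finite B → Finite A
↔-finite A↔B (n , B↔Fin) = n , ↔-trans A↔B B↔Fin

⊎-finite : {A B : Set} → Finite A → Finite B → Finite (A ⊎ B)
⊎-finite (m , A↔Fin) (n , B↔Fin) = m ℕ.+ n , ↔-trans (A↔Fin ⊎-↔ B↔Fin) (↔-sym +↔⊎)

×-finite : {A B : Set} → Finite A → Finite B → Finite (A × B)
×-finite (m , A↔Fin) (n , B↔Fin) = m ℕ.* n , ↔-trans (A↔Fin ×-↔ B↔Fin) (↔-sym *↔×)

⊤-finite : Finite ⊤
⊤-finite = 1 , ↔-sym 1↔⊤

True-finite : {P : Set} (P? : Dec P) → Finite (True P?)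
True-finite (yes _) = ⊤-finite
True-finite (no _)  = 0 , ↔-sym 0↔⊥

Fin-Subtype-finite : ∀ {n} {P : Pred (Fin n) 0ℓ} (P? : Decidable P) → Finite (Subtype P?)
Fin-Subtype-finite {zero} P? =
  0 , mk↔ₛ′ (λ { (() , _) }) (λ ()) (λ ()) (λ { (() , _) })
Fin-Subtype-finite {suc n} P? =
  ↔-finite split (⊎-finite (True-finite (P? zero)) (Fin-Subtype-finite (P? ∘ suc)))
  where
  split : Subtype P? ↔ (True (P? zero) ⊎ Subtype (P? ∘ suc))
  split = mk↔ₛ′
    (λ { (zero , p) → inj₁ p ; (suc i , p) → inj₂ (i , p) })
    (λ { (inj₁ p) → zero , p ; (inj₂ (i , p)) → suc i , p })
    (λ { (inj₁ _) → refl ; (inj₂ _) → refl })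
    (λ { (zero , _) → refl ; (suc _ , _) → refl })

Subtype-finite : {A : Set} {P : Pred A 0ℓ} → Finite A → (P? : Decidable P) → Finite (Subtype P?)
Subtype-finite (n , A↔Fin) P? =
  ↔-finite (↔-sym (Σ-↔ (↔-sym A↔Fin) ↔-refl)) (Fin-Subtype-finite (P? ∘ Inverse.from A↔Fin))

∃?-finite : {A : Set} {P : Pred A 0ℓ} → Finite A → Decidable P → Dec (∃ P)
∃?-finite {P = P} (n , A↔Fin) P? = map′
  (λ (i , p) → from i , p)
  (λ (x , p) → to x , subst P (sym (strictlyInverseʳ x)) p)
  (any? (P? ∘ from))
  where open Inverse A↔Fin

≟-finite : {A : Set} → Finite A → DecidableEquality A
≟-finite (n , A↔Fin) = via-injection (↔⇒↣ A↔Fin) _≟ᶠ_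

Tri-middle? : {A B C : Set} → Tri A B C → Dec B
Tri-middle? (tri< _ ¬b _) = no ¬b
Tri-middle? (tri≈ _ b _)  = yes b
Tri-middle? (tri> _ ¬b _) = no ¬b

module Involution {A : Set} (σ : A → A) (σ-involutive : ∀ x → σ (σ x) ≡ x)
                  {Lower : Pred A 0ℓ} (lower? : Decidable Lower)
                  (trichotomy : ∀ x → Tri (Lower x) (σ x ≡ x) (Lower (σ x))) where

  fixed? : Decidable (λ x → σ x ≡ x)
  fixed? = Tri-middle? ∘ trichotomy

  lower⇒¬lower-σ : ∀ {x} → Lower x → ¬ Lower (σ x)
  lower⇒¬lower-σ {x} l with trichotomy x
  ... | tri< _ _ ¬l = ¬l
  ... | tri≈ ¬l _ _ = contradiction l ¬l
  ... | tri> ¬l _ _ = contradiction l ¬l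

  Fixed Lowered : Set
  Fixed   = Subtype fixed?
  Lowered = Subtype lower?

  orbit-decomposition : A ↔ (Fixed ⊎ (Lowered ⊎ Lowered))
  orbit-decomposition = mk↔ₛ′ to from to∘from from∘to
    where
    to : A → Fixed ⊎ (Lowered ⊎ Lowered)
    to x with trichotomy x
    ... | tri< l _ _ = inj₂ (inj₁ (x , fromWitness l))
    ... | tri≈ _ f _ = inj₁ (x , fromWitness f)
    ... | tri> _ _ l = inj₂ (inj₂ (σ x , fromWitness l))

    from : Fixed ⊎ (Lowered ⊎ Lowered) → A
    from (inj₁ (x , _))        = x
    from (inj₂ (inj₁ (x , _))) = x
    from (inj₂ (inj₂ (x , _))) = σ x

    from∘to : ∀ x → from (to x) ≡ x
    from∘to x with trichotomy x
    ... | tri< _ _ _ = refl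
    ... | tri≈ _ _ _ = refl
    ... | tri> _ _ _ = σ-involutive x

    to-fixed : ∀ x → σ x ≡ x → Σ Fixed λ y → proj₁ y ≡ x × to x ≡ inj₁ y
    to-fixed x f with trichotomy x
    ... | tri< _ ¬f _ = contradiction f ¬f
    ... | tri≈ _ _ _  = _ , refl , refl
    ... | tri> _ ¬f _ = contradiction f ¬f

    to∘from : ∀ y → to (from y) ≡ y
    to∘from (inj₁ (x , f)) with to-fixed x (toWitness f)
    ... | _ , y≡x , to-x≡y = trans to-x≡y (cong inj₁ (Subtype-≡ y≡x))
    to∘from (inj₂ (inj₁ (x , l))) with trichotomy x
    ... | tri< _ _ _  = cong (inj₂ ∘ inj₁) (Subtype-≡ refl)
    ... | tri≈ ¬l _ _ = contradiction (toWitness l) ¬l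
    ... | tri> ¬l _ _ = contradiction (toWitness l) ¬l
    to∘from (inj₂ (inj₂ (x , l))) with trichotomy (σ x)
    ... | tri< l′ _ _  = contradiction l′ (lower⇒¬lower-σ (toWitness l))
    ... | tri≈ _ _ ¬l′ = contradiction (subst Lower (sym (σ-involutive x)) (toWitness l)) ¬l′
    ... | tri> _ _ _   = cong (inj₂ ∘ inj₂) (Subtype-≡ (σ-involutive x))

  orbit-count : ∀ {n f l} → A ↔ Fin n → Fixed ↔ Fin f → Lowered ↔ Fin l → n ≡ f ℕ.+ (l ℕ.+ l)
  orbit-count A↔Fin Fixed↔Fin Lowered↔Fin = ↔⇒≡ (↔-trans (↔-sym A↔Fin) (↔-trans orbit-decomposition
    (proj₂ (⊎-finite (_ , Fixed↔Fin) (⊎-finite (_ , Lowered↔Fin) (_ , Lowered↔Fin))))))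

  unique-fixed-point : ∀ {a} → σ a ≡ a → (∀ x → σ x ≡ x → x ≡ a) → Fixed ↔ Fin 1
  unique-fixed-point {a} σa≡a unique = mk↔ₛ′
    (λ _ → zero) (λ _ → a , fromWitness σa≡a)
    (λ { zero → refl ; (suc ()) }) (λ (x , f) → Subtype-≡ (sym (unique x (toWitness f))))

module _ {A : Set} {n} (ι : A → Fin n) (ι-injective : ∀ {x y} → ι x ≡ ι y → x ≡ y)
         (σ : A → A) (σ-involutive : ∀ x → σ (σ x) ≡ x) where

  lower-trichotomy : ∀ x → Tri (ι x <ᶠ ι (σ x)) (σ x ≡ x) (ι (σ x) <ᶠ ι (σ (σ x)))
  lower-trichotomy x with <-cmp (ι x) (ι (σ x))
  ... | tri< a ¬b ¬c = tri< a (¬b ∘ cong ι ∘ sym) (¬c ∘ subst (λ y → ι (σ x) <ᶠ ι y) (σ-involutive x))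
  ... | tri≈ ¬a b ¬c = tri≈ ¬a (sym (ι-injective b)) (¬c ∘ subst (λ y → ι (σ x) <ᶠ ι y) (σ-involutive x))
  ... | tri> ¬a ¬b c = tri> ¬a (¬b ∘ cong ι ∘ sym) (subst (λ y → ι (σ x) <ᶠ ι y) (sym (σ-involutive x)) c)

module FieldProperties {q : ℕ} (F : FiniteField q) where
  open FiniteField F

  commutativeRing : CommutativeRing 0ℓ 0ℓ
  commutativeRing = record { isCommutativeRing = isCommutativeRing }

  open CommutativeRing commutativeRing public
    using (+-comm; *-assoc; *-comm; *-identityˡ; *-identityʳ; distribˡ; zeroˡ; zeroʳ)
  open import Algebra.Properties.Ring (CommutativeRing.ring commutativeRing) public
    using ( -1*x≈-x; -‿involutive; -‿injective; -‿distribˡ-*; -‿distribʳ-*; x[y-z]≈xy-xz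
          ; +-inverseˡ-unique; ⁻¹-anti-homo‿-)
  open import Algebra.Properties.CommutativeSemigroup (CommutativeRing.*-commutativeSemigroup commutativeRing)
    using (interchange)
  open ≡-Reasoning

  infix 4 _≟_
  _≟_ : DecidableEquality Carrier
  _≟_ = ≟-finite (q , enumeration)

  index : Carrier → Fin q
  index = Inverse.to enumeration

  index-injective : ∀ {x y} → index x ≡ index y → x ≡ y
  index-injective = Injection.injective (↔⇒↣ enumeration)

  1≢0 : 1# ≢ 0#
  1≢0 = 0≢1 ∘ sym

  -- 0# ⁻¹ is the junk value 0#.
  _⁻¹ : Carrier → Carrier
  x ⁻¹ with x ≟ 0#
  ... | yes _   = 0#
  ... | no x≢0 = proj₁ (inverse x x≢0)

  ⁻¹-inverseʳ : ∀ {x} → x ≢ 0# → x * x ⁻¹ ≡ 1#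
  ⁻¹-inverseʳ {x} x≢0 with x ≟ 0#
  ... | yes x≡0 = contradiction x≡0 x≢0
  ... | no x≢0  = proj₂ (inverse x x≢0)

  ⁻¹-inverseˡ : ∀ {x} → x ≢ 0# → x ⁻¹ * x ≡ 1#
  ⁻¹-inverseˡ {x} x≢0 = trans (*-comm (x ⁻¹) x) (⁻¹-inverseʳ x≢0)

  y≡x⁻¹*z : ∀ {x y z} → x ≢ 0# → x * y ≡ z → y ≡ x ⁻¹ * z
  y≡x⁻¹*z {x} {y} {z} x≢0 xy≡z = begin
    y              ≡⟨ sym (*-identityˡ y) ⟩
    1# * y         ≡⟨ cong (_* y) (sym (⁻¹-inverseˡ x≢0)) ⟩
    x ⁻¹ * x * y   ≡⟨ *-assoc (x ⁻¹) x y ⟩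
    x ⁻¹ * (x * y) ≡⟨ cong (x ⁻¹ *_) xy≡z ⟩
    x ⁻¹ * z       ∎

  *-cancelˡ : ∀ {a x y} → a ≢ 0# → a * x ≡ a * y → x ≡ y
  *-cancelˡ a≢0 ax≡ay = trans (y≡x⁻¹*z a≢0 ax≡ay) (sym (y≡x⁻¹*z a≢0 refl))

  *-cancelʳ : ∀ {a x y} → a ≢ 0# → x * a ≡ y * a → x ≡ y
  *-cancelʳ {a} {x} {y} a≢0 xa≡ya = *-cancelˡ a≢0 (trans (*-comm a x) (trans xa≡ya (*-comm y a)))

  *-≢0 : ∀ {x y} → x ≢ 0# → y ≢ 0# → x * y ≢ 0#
  *-≢0 {x} x≢0 y≢0 xy≡0 = y≢0 (*-cancelˡ x≢0 (trans xy≡0 (sym (zeroʳ x))))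

  *≡1⇒≢0 : ∀ {x y} → x * y ≡ 1# → x ≢ 0#
  *≡1⇒≢0 {x} {y} xy≡1 x≡0 = 0≢1 (trans (sym (zeroˡ y)) (trans (cong (_* y) (sym x≡0)) xy≡1))

  inverse-unique : ∀ {x y} → x * y ≡ 1# → x ⁻¹ ≡ y
  inverse-unique xy≡1 = *-cancelˡ (*≡1⇒≢0 xy≡1) (trans (⁻¹-inverseʳ (*≡1⇒≢0 xy≡1)) (sym xy≡1))

  ⁻¹-≢0 : ∀ {x} → x ≢ 0# → x ⁻¹ ≢ 0#
  ⁻¹-≢0 x≢0 = *≡1⇒≢0 (⁻¹-inverseˡ x≢0)

  ⁻¹-involutive : ∀ {x} → x ≢ 0# → x ⁻¹ ⁻¹ ≡ x
  ⁻¹-involutive x≢0 = inverse-unique (⁻¹-inverseˡ x≢0)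

  1⁻¹≡1 : 1# ⁻¹ ≡ 1#
  1⁻¹≡1 = inverse-unique (*-identityˡ 1#)

  x*x≡1⇒x≡±1 : ∀ {x} → x * x ≡ 1# → x ≡ 1# ⊎ x ≡ - 1#
  x*x≡1⇒x≡±1 {x} xx≡1 with (x + 1#) ≟ 0#
  ... | yes x+1≡0 = inj₂ (+-inverseˡ-unique x 1# x+1≡0)
  ... | no x+1≢0  = inj₁ (*-cancelʳ x+1≢0 (begin
    x * (x + 1#)       ≡⟨ distribˡ x x 1# ⟩
    x * x + x * 1#     ≡⟨ cong₂ _+_ xx≡1 (*-identityʳ x) ⟩
    1# + x             ≡⟨ +-comm 1# x ⟩
    x + 1#             ≡⟨ sym (*-identityˡ (x + 1#)) ⟩
    1# * (x + 1#)      ∎))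

  x≡-x⇒-1≡1 : ∀ {x} → x ≢ 0# → x ≡ - x → - 1# ≡ 1#
  x≡-x⇒-1≡1 {x} x≢0 x≡-x = *-cancelˡ x≢0 (begin
    x * - 1#   ≡⟨ sym (-‿distribʳ-* x 1#) ⟩
    - (x * 1#) ≡⟨ cong -_ (*-identityʳ x) ⟩
    - x        ≡⟨ sym x≡-x ⟩
    x          ≡⟨ sym (*-identityʳ x) ⟩
    x * 1#     ∎)

  ^-distrib-* : ∀ x y n → (x * y) ^ n ≡ x ^ n * y ^ n
  ^-distrib-* x y zero    = sym (*-identityˡ 1#)
  ^-distrib-* x y (suc n) = trans (cong (x * y *_) (^-distrib-* x y n)) (interchange x y (x ^ n) (y ^ n))

  1^n≡1 : ∀ n → 1# ^ n ≡ 1#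
  1^n≡1 zero    = refl
  1^n≡1 (suc n) = trans (*-identityˡ (1# ^ n)) (1^n≡1 n)

  ^-≢0 : ∀ {x} n → x ≢ 0# → x ^ n ≢ 0#
  ^-≢0 zero    x≢0 = 1≢0
  ^-≢0 (suc n) x≢0 = *-≢0 x≢0 (^-≢0 n x≢0)

  x*[y-z]≡-x*[z-y] : ∀ x y z → x * (y - z) ≡ - x * (z - y)
  x*[y-z]≡-x*[z-y] x y z = begin
    x * (y - z)     ≡⟨ cong (x *_) (sym (⁻¹-anti-homo‿- z y)) ⟩
    x * - (z - y)   ≡⟨ sym (-‿distribʳ-* x (z - y)) ⟩
    - (x * (z - y)) ≡⟨ -‿distribˡ-* x (z - y) ⟩
    - x * (z - y)   ∎

n+n≡n*2 : ∀ n → n ℕ.+ n ≡ n ℕ.* 2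
n+n≡n*2 n = trans (cong (n ℕ.+_) (sym (ℕₚ.+-identityʳ n))) (ℕₚ.*-comm 2 n)

¬2∣1+n+n : ∀ n → ¬ 2 ∣ suc (n ℕ.+ n)
¬2∣1+n+n n 2∣1+n+n = contradiction (∣1⇒≡1 2∣1) λ ()
  where
  2∣1 : 2 ∣ 1
  2∣1 = ∣m+n∣m⇒∣n (subst (2 ∣_) (ℕₚ.+-comm 1 (n ℕ.+ n)) 2∣1+n+n) (divides n (n+n≡n*2 n))

module Powers {q : ℕ} (F : FiniteField q) (e : ℕ) where
  open FiniteField F
  open FieldProperties F
  open ≡-Reasoning

  IsPower : Pred Carrier 0ℓ
  IsPower h = ∃ λ z → z ≢ 0# × h ≡ z ^ e

  IsPower? : Decidable IsPower
  IsPower? h = ∃?-finite (q , enumeration) (λ z → ¬? (z ≟ 0#) ×-dec (h ≟ z ^ e))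

  isPower⇒≢0 : ∀ {h} → IsPower h → h ≢ 0#
  isPower⇒≢0 (z , z≢0 , h≡zᵉ) h≡0 = ^-≢0 e z≢0 (trans (sym h≡zᵉ) h≡0)

  *-isPower : ∀ {x y} → IsPower x → IsPower y → IsPower (x * y)
  *-isPower (z , z≢0 , x≡zᵉ) (w , w≢0 , y≡wᵉ) =
    z * w , *-≢0 z≢0 w≢0 , trans (cong₂ _*_ x≡zᵉ y≡wᵉ) (sym (^-distrib-* z w e))

  ⁻¹-isPower : ∀ {h} → IsPower h → IsPower (h ⁻¹)
  ⁻¹-isPower {h} (z , z≢0 , h≡zᵉ) = z ⁻¹ , ⁻¹-≢0 z≢0 , inverse-unique (begin
    h * (z ⁻¹) ^ e       ≡⟨ cong (_* (z ⁻¹) ^ e) h≡zᵉ ⟩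
    z ^ e * (z ⁻¹) ^ e   ≡⟨ sym (^-distrib-* z (z ⁻¹) e) ⟩
    (z * z ⁻¹) ^ e       ≡⟨ cong (_^ e) (⁻¹-inverseʳ z≢0) ⟩
    1# ^ e               ≡⟨ 1^n≡1 e ⟩
    1#                   ∎)

  sameCoset⇒scaled : ∀ {x y} → SameCoset e x y → ∃ λ h → IsPower h × x ≡ h * y
  sameCoset⇒scaled {x} {y} (z , z≢0 , x≡yzᵉ) = z ^ e , (z , z≢0 , refl) , trans x≡yzᵉ (*-comm y (z ^ e))

  scaled⇒sameCoset : ∀ {h x y} → IsPower h → x ≡ h * y → SameCoset e x y
  scaled⇒sameCoset {h} {x} {y} (z , z≢0 , h≡zᵉ) x≡hy =
    z , z≢0 , trans x≡hy (trans (*-comm h y) (cong (y *_) h≡zᵉ))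

  sameCoset-sym : ∀ {x y} → SameCoset e x y → SameCoset e y x
  sameCoset-sym s with sameCoset⇒scaled s
  ... | h , p , x≡hy = scaled⇒sameCoset (⁻¹-isPower p) (y≡x⁻¹*z (isPower⇒≢0 p) (sym x≡hy))

  scaled-ratio⇒sameCoset : ∀ {h h′ x y} → IsPower h → IsPower h′ → h * x ≡ h′ * y → SameCoset e x y
  scaled-ratio⇒sameCoset {h} {h′} {x} {y} p p′ hx≡h′y = scaled⇒sameCoset (*-isPower (⁻¹-isPower p) p′)
    (trans (y≡x⁻¹*z (isPower⇒≢0 p) hx≡h′y) (sym (*-assoc (h ⁻¹) h′ y)))

  H : Set
  H = Subtype IsPower?

  H-finite : Finite H
  H-finite = Subtype-finite (q , enumeration) IsPower?

  #H : ℕ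
  #H = proj₁ H-finite

  module Representatives {I : Set} (r : I → Carrier) (r≢0 : ∀ i → r i ≢ 0#)
                         (r-distinct : ∀ i j → SameCoset e (r i) (r j) → i ≡ j) where

    scaled-injective : ∀ {h h′ i j} → IsPower h → IsPower h′ → h * r i ≡ h′ * r j → i ≡ j × h ≡ h′
    scaled-injective p p′ hrᵢ≡h′rⱼ with r-distinct _ _ (scaled-ratio⇒sameCoset p p′ hrᵢ≡h′rⱼ)
    ... | refl = refl , *-cancelʳ (r≢0 _) hrᵢ≡h′rⱼ

    module _ (r-complete : ∀ x → x ≢ 0# → ∃ λ i → SameCoset e (r i) x) where

      scaled-complete : ∀ {x} → x ≢ 0# → Σ I λ i → ∃ λ h → IsPower h × x ≡ h * r i
      scaled-complete {x} x≢0 =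
        let i , rᵢ~x = r-complete x x≢0 in i , sameCoset⇒scaled (sameCoset-sym rᵢ~x)

      coset-decomposition : Carrier ↔ (⊤ ⊎ (I × H))
      coset-decomposition = mk↔ₛ′ to from to∘from from∘to
        where
        to : Carrier → ⊤ ⊎ (I × H)
        to x with x ≟ 0#
        ... | yes _   = inj₁ tt
        ... | no x≢0 = let i , h , p , _ = scaled-complete x≢0 in inj₂ (i , h , fromWitness p)

        from : ⊤ ⊎ (I × H) → Carrier
        from (inj₁ _)             = 0#
        from (inj₂ (i , h , _)) = h * r i

        from∘to : ∀ x → from (to x) ≡ x
        from∘to x with x ≟ 0#
        ... | yes x≡0 = sym x≡0
        ... | no x≢0  = let _ , _ , _ , x≡hrᵢ = scaled-complete x≢0 in sym x≡hrᵢ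

        to∘from : ∀ y → to (from y) ≡ y
        to∘from (inj₁ tt) with 0# ≟ 0#
        ... | yes _   = refl
        ... | no 0≢0 = contradiction refl 0≢0
        to∘from (inj₂ (i , h , p)) with (h * r i) ≟ 0#
        ... | yes hrᵢ≡0 = contradiction hrᵢ≡0 (*-≢0 (isPower⇒≢0 (toWitness p)) (r≢0 i))
        ... | no hrᵢ≢0 =
          let j , h′ , p′ , hrᵢ≡h′rⱼ = scaled-complete hrᵢ≢0
              i≡j , h≡h′ = scaled-injective (toWitness p) p′ hrᵢ≡h′rⱼ
          in cong inj₂ (cong₂ _,_ (sym i≡j) (Subtype-≡ (sym h≡h′)))

  inversion : H → H
  inversion (h , p) = h ⁻¹ , fromWitness (⁻¹-isPower (toWitness p))

  inversion-involutive : ∀ x → inversion (inversion x) ≡ x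
  inversion-involutive (h , p) = Subtype-≡ (⁻¹-involutive (isPower⇒≢0 (toWitness p)))

  -- Otherwise 1 would be the only fixed point of inversion on H, and |H| would be odd.
  even⇒-1-isPower : 2 ∣ #H → IsPower (- 1#) × - 1# ≢ 1#
  even⇒-1-isPower 2∣#H = decidable-stable (IsPower? (- 1#) ×-dec ¬? (- 1# ≟ 1#)) λ ¬goal →
    ¬2∣1+n+n #Lowered (subst (2 ∣_) (#H-odd ¬goal) 2∣#H)
    where
    ι : H → Fin q
    ι = index ∘ proj₁

    lower? : Decidable (λ x → ι x <ᶠ ι (inversion x))
    lower? x = ι x <? ι (inversion x)

    open Involution inversion inversion-involutive lower?
      (lower-trichotomy ι (Subtype-≡ ∘ index-injective) inversion inversion-involutive)

    one : H
    one = 1# , fromWitness (1# , 1≢0 , sym (1^n≡1 e))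

    one-fixed : inversion one ≡ one
    one-fixed = Subtype-≡ 1⁻¹≡1

    only-fixed : ¬ (IsPower (- 1#) × - 1# ≢ 1#) → ∀ x → inversion x ≡ x → x ≡ one
    only-fixed ¬goal (h , p) h⁻¹≡h = Subtype-≡ (±1⇒1 (x*x≡1⇒x≡±1 h*h≡1))
      where
      h*h≡1 : h * h ≡ 1#
      h*h≡1 = trans (cong (h *_) (sym (cong proj₁ h⁻¹≡h))) (⁻¹-inverseʳ (isPower⇒≢0 (toWitness p)))

      ±1⇒1 : h ≡ 1# ⊎ h ≡ - 1# → h ≡ 1#
      ±1⇒1 (inj₁ h≡1)  = h≡1
      ±1⇒1 (inj₂ h≡-1) = trans h≡-1 (decidable-stable (- 1# ≟ 1#) λ -1≢1 →
                           ¬goal (subst IsPower h≡-1 (toWitness p) , -1≢1))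

    #Lowered : ℕ
    #Lowered = proj₁ (Subtype-finite H-finite lower?)

    #H-odd : ¬ (IsPower (- 1#) × - 1# ≢ 1#) → #H ≡ suc (#Lowered ℕ.+ #Lowered)
    #H-odd ¬goal = orbit-count (proj₂ H-finite) (unique-fixed-point one-fixed (only-fixed ¬goal))
                               (proj₂ (Subtype-finite H-finite lower?))

  module HalfSystem (-1-isPower : IsPower (- 1#)) (-1≢1 : - 1# ≢ 1#) where

    -‿isPower : ∀ {h} → IsPower h → IsPower (- h)
    -‿isPower {h} p = subst IsPower (-1*x≈-x h) (*-isPower -1-isPower p)

    lower? : Decidable (λ x → index x <ᶠ index (- x))
    lower? x = index x <? index (- x)

    open Involution -_ -‿involutive lower? (lower-trichotomy index index-injective -_ -‿involutive)
      using (lower⇒¬lower-σ)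

    InS? : Decidable (λ x → IsPower x × index x <ᶠ index (- x))
    InS? x = IsPower? x ×-dec lower? x

    S-finite : Finite (Subtype InS?)
    S-finite = Subtype-finite (q , enumeration) InS?

    #S : ℕ
    #S = proj₁ S-finite

    open Inverse (proj₂ S-finite) using (to; from; strictlyInverseʳ)

    s : Fin #S → Carrier
    s t = proj₁ (from t)

    s-inS : ∀ t → IsPower (s t) × index (s t) <ᶠ index (- s t)
    s-inS t = toWitness (proj₂ (from t))

    s-isPower : ∀ t → IsPower (s t)
    s-isPower = proj₁ ∘ s-inS

    -s-isPower : ∀ t → IsPower (- s t)
    -s-isPower = -‿isPower ∘ s-isPower

    s-injective : ∀ {t t′} → s t ≡ s t′ → t ≡ t′
    s-injective = Injection.injective (↔⇒↣ (↔-sym (proj₂ S-finite))) ∘ Subtype-≡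

    s≢-s : ∀ t t′ → s t ≢ - s t′
    s≢-s t t′ sₜ≡-sₜ′ = lower⇒¬lower-σ (proj₂ (s-inS t′)) (subst (λ x → index x <ᶠ index (- x)) sₜ≡-sₜ′ lowerₜ)
      where
      lowerₜ : index (s t) <ᶠ index (- s t)
      lowerₜ = proj₂ (s-inS t)

    half-system : ∀ {h} → IsPower h → ∃ λ t → s t ≡ h ⊎ s t ≡ - h
    half-system {h} p with lower-trichotomy index index-injective -_ -‿involutive h
    ... | tri< l _ _    = to (h , fromWitness (p , l)) , inj₁ (cong proj₁ (strictlyInverseʳ _))
    ... | tri≈ _ -h≡h _ = contradiction (x≡-x⇒-1≡1 (isPower⇒≢0 p) (sym -h≡h)) -1≢1
    ... | tri> _ _ l    = to (- h , fromWitness (-‿isPower p , l)) , inj₂ (cong proj₁ (strictlyInverseʳ _))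

increasing-pair : ∀ {k} → 1 ℕ.< k → Σ (Fin k × Fin k) λ p → proj₁ p <ᶠ proj₂ p
increasing-pair (s≤s (s≤s z≤n)) = (zero , suc zero) , s≤s z≤n

module _ {q : ℕ} (F : FiniteField q) where
  open FiniteField F

  module BanffFamily (e : ℕ) {k : ℕ} (1<k : 1 ℕ.< k) (k[k-1]∣q-1 : k ℕ.* (k ∸ 1) ∣ q ∸ 1)
    (b : Fin k → Carrier)
    (differences≢0 : ∀ i j → i <ᶠ j → b i - b j ≢ 0#)
    (differences-complete : ∀ x → x ≢ 0# →
                            Σ (Fin k) λ i → Σ (Fin k) λ j → (i <ᶠ j) × SameCoset e (b i - b j) x)
    (differences-distinct : ∀ i j i′ j′ → i <ᶠ j → i′ <ᶠ j′ →
                            SameCoset e (b i - b j) (b i′ - b j′) → (i ≡ i′) × (j ≡ j′))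
    (b≢0 : ∀ i → b i ≢ 0#)
    (b-distinct : ∀ i j → SameCoset e (b i) (b j) → i ≡ j)
    where

    open FieldProperties F
    open Powers F e
    open ≡-Reasoning

    increasing? : Decidable (λ (p : Fin k × Fin k) → proj₁ p <ᶠ proj₂ p)
    increasing? (i , j) = i <? j

    Increasing : Set
    Increasing = Subtype increasing?

    δ : Increasing → Carrier
    δ ((i , j) , _) = b i - b j

    δ≢0 : ∀ p → δ p ≢ 0#
    δ≢0 ((i , j) , i<j) = differences≢0 i j (toWitness i<j)

    δ-distinct : ∀ p p′ → SameCoset e (δ p) (δ p′) → p ≡ p′
    δ-distinct ((i , j) , i<j) ((i′ , j′) , i′<j′) δ~δ′ =
      let i≡i′ , j≡j′ = differences-distinct i j i′ j′ (toWitness i<j) (toWitness i′<j′) δ~δ′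
      in Subtype-≡ (cong₂ _,_ i≡i′ j≡j′)

    module δ-reps = Representatives δ δ≢0 δ-distinct
    module b-reps = Representatives b b≢0 b-distinct

    δ-complete : ∀ x → x ≢ 0# → ∃ λ p → SameCoset e (δ p) x
    δ-complete x x≢0 = let i , j , i<j , δ~x = differences-complete x x≢0 in ((i , j) , fromWitness i<j) , δ~x

    scaled-differences-injective : ∀ {h h′ i j i′ j′} → i <ᶠ j → i′ <ᶠ j′ → IsPower h → IsPower h′ →
                                   h * (b i - b j) ≡ h′ * (b i′ - b j′) → i ≡ i′ × j ≡ j′ × h ≡ h′
    scaled-differences-injective {i = i} {j} {i′} {j′} i<j i′<j′ p p′ hδ≡h′δ′ =
      let p≡p′ , h≡h′ = δ-reps.scaled-injective {i = (i , j) , fromWitness i<j}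
                                                  {j = (i′ , j′) , fromWitness i′<j′} p p′ hδ≡h′δ′
      in cong (proj₁ ∘ proj₁) p≡p′ , cong (proj₂ ∘ proj₁) p≡p′ , h≡h′

    Increasing-finite : Finite Increasing
    Increasing-finite = Subtype-finite (k ℕ.* k , ↔-sym *↔×) increasing?

    #Increasing : ℕ
    #Increasing = proj₁ Increasing-finite

    k*[k-1]≡#Increasing*2 : k ℕ.* (k ∸ 1) ≡ #Increasing ℕ.* 2
    k*[k-1]≡#Increasing*2 = begin
      k ℕ.* (k ∸ 1)                           ≡⟨ ℕₚ.*-distribˡ-∸ k k 1 ⟩
      k ℕ.* k ∸ k ℕ.* 1                       ≡⟨ cong₂ _∸_ k*k≡k+2#Increasing (ℕₚ.*-identityʳ k) ⟩
      k ℕ.+ (#Increasing ℕ.+ #Increasing) ∸ k ≡⟨ ℕₚ.m+n∸m≡n k _ ⟩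
      #Increasing ℕ.+ #Increasing             ≡⟨ n+n≡n*2 #Increasing ⟩
      #Increasing ℕ.* 2                       ∎
      where
      swap : Fin k × Fin k → Fin k × Fin k
      swap (i , j) = j , i

      swap-trichotomy : ∀ p → Tri (proj₁ p <ᶠ proj₂ p) (swap p ≡ p) (proj₂ p <ᶠ proj₁ p)
      swap-trichotomy (i , j) with <-cmp i j
      ... | tri< i<j i≢j j≮i = tri< i<j (i≢j ∘ sym ∘ cong proj₁) j≮i
      ... | tri≈ i≮j refl j≮i = tri≈ i≮j refl j≮i
      ... | tri> i≮j i≢j j<i = tri> i≮j (i≢j ∘ sym ∘ cong proj₁) j<i

      open Involution swap (λ _ → refl) increasing? swap-trichotomy

      diagonal : Fixed ↔ Fin k
      diagonal = mk↔ₛ′ (proj₁ ∘ proj₁) (λ i → (i , i) , fromWitness refl) (λ _ → refl)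
        (λ ((i , j) , f) → Subtype-≡ (cong (i ,_) (sym (cong proj₁ (toWitness f)))))

      k*k≡k+2#Increasing : k ℕ.* k ≡ k ℕ.+ (#Increasing ℕ.+ #Increasing)
      k*k≡k+2#Increasing = orbit-count (↔-sym *↔×) diagonal (proj₂ Increasing-finite)

    q≡1+#Increasing*#H : q ≡ suc (#Increasing ℕ.* #H)
    q≡1+#Increasing*#H = ↔⇒≡ (↔-trans (↔-sym enumeration) (↔-trans (δ-reps.coset-decomposition δ-complete)
      (proj₂ (⊎-finite ⊤-finite (×-finite Increasing-finite H-finite)))))

    2∣#H : 2 ∣ #H
    2∣#H = *-cancelˡ-∣ #Increasing {{nonZeroIndex (Inverse.to (proj₂ Increasing-finite) first-pair)}}
      (subst₂ _∣_ k*[k-1]≡#Increasing*2 (cong (_∸ 1) q≡1+#Increasing*#H) k[k-1]∣q-1)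
      where
      first-pair : Increasing
      first-pair = let p , p₁<p₂ = increasing-pair 1<k in p , fromWitness p₁<p₂

    -1-isPower×-1≢1 : IsPower (- 1#) × - 1# ≢ 1#
    -1-isPower×-1≢1 = even⇒-1-isPower 2∣#H

    module Family (-1-isPower : IsPower (- 1#)) (-1≢1 : - 1# ≢ 1#) where
      open HalfSystem -1-isPower -1≢1 public

      B : Fin #S → Fin k → Carrier
      B t i = s t * b i

      B-difference : ∀ t i j → B t i - B t j ≡ s t * (b i - b j)
      B-difference t i j = sym (x[y-z]≈xy-xz (s t) (b i) (b j))

      blocks-injective : ∀ t → InjectiveBlock F k (B t)
      blocks-injective t i j Bₜᵢ≡Bₜⱼ =
        proj₁ (b-reps.scaled-injective (s-isPower t) (s-isPower t) Bₜᵢ≡Bₜⱼ)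

      differences-cover : ∀ g → g ≢ 0# →
                          Σ (Fin #S) λ t → Σ (Fin k) λ i → Σ (Fin k) λ j → (i ≢ j) × (g ≡ B t i - B t j)
      differences-cover g g≢0 with δ-reps.scaled-complete δ-complete g≢0
      ... | ((i , j) , i<j) , h , p , g≡hδ with half-system p
      ...   | t , inj₁ sₜ≡h  = t , i , j , <⇒≢ (toWitness i<j) , (begin
        g                  ≡⟨ g≡hδ ⟩
        h * (b i - b j)    ≡⟨ cong (_* (b i - b j)) (sym sₜ≡h) ⟩
        s t * (b i - b j)  ≡⟨ sym (B-difference t i j) ⟩
        B t i - B t j      ∎)
      ...   | t , inj₂ sₜ≡-h = t , j , i , <⇒≢ (toWitness i<j) ∘ sym , (begin
        g                  ≡⟨ g≡hδ ⟩
        h * (b i - b j)    ≡⟨ x*[y-z]≡-x*[z-y] h (b i) (b j) ⟩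
        - h * (b j - b i)  ≡⟨ cong (_* (b j - b i)) (sym sₜ≡-h) ⟩
        s t * (b j - b i)  ≡⟨ sym (B-difference t j i) ⟩
        B t j - B t i      ∎)

      scaled-differences-unique : ∀ {t i j t′ i′ j′} → i ≢ j → i′ ≢ j′ →
                                  s t * (b i - b j) ≡ s t′ * (b i′ - b j′) → (t ≡ t′) × (i ≡ i′) × (j ≡ j′)
      scaled-differences-unique {t} {i} {j} {t′} {i′} {j′} i≢j i′≢j′ sδ≡s′δ′ with <-cmp i j | <-cmp i′ j′
      ... | tri≈ _ i≡j _ | _              = contradiction i≡j i≢j
      ... | _            | tri≈ _ i′≡j′ _ = contradiction i′≡j′ i′≢j′
      ... | tri< i<j _ _ | tri< i′<j′ _ _ =
        let i≡i′ , j≡j′ , sₜ≡sₜ′ = scaled-differences-injective i<j i′<j′ (s-isPower t) (s-isPower t′) sδ≡s′δ′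
        in s-injective sₜ≡sₜ′ , i≡i′ , j≡j′
      ... | tri< i<j _ _ | tri> _ _ j′<i′ =
        let _ , _ , sₜ≡-sₜ′ = scaled-differences-injective i<j j′<i′ (s-isPower t) (-s-isPower t′)
                                (trans sδ≡s′δ′ (x*[y-z]≡-x*[z-y] _ _ _))
        in contradiction sₜ≡-sₜ′ (s≢-s t t′)
      ... | tri> _ _ j<i | tri< i′<j′ _ _ =
        let _ , _ , -sₜ≡sₜ′ = scaled-differences-injective j<i i′<j′ (-s-isPower t) (s-isPower t′)
                                (trans (sym (x*[y-z]≡-x*[z-y] _ _ _)) sδ≡s′δ′)
        in contradiction (sym -sₜ≡sₜ′) (s≢-s t′ t)
      ... | tri> _ _ j<i | tri> _ _ j′<i′ =
        let j≡j′ , i≡i′ , -sₜ≡-sₜ′ = scaled-differences-injective j<i j′<i′ (-s-isPower t) (-s-isPower t′)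
                                       (trans (sym (x*[y-z]≡-x*[z-y] _ _ _)) (trans sδ≡s′δ′ (x*[y-z]≡-x*[z-y] _ _ _)))
        in s-injective (-‿injective -sₜ≡-sₜ′) , i≡i′ , j≡j′

      differences-unique : ∀ t i j t′ i′ j′ → i ≢ j → i′ ≢ j′ → B t i - B t j ≡ B t′ i′ - B t′ j′ →
                           (t ≡ t′) × (i ≡ i′) × (j ≡ j′)
      differences-unique t i j t′ i′ j′ i≢j i′≢j′ Bₜ≡Bₜ′ = scaled-differences-unique i≢j i′≢j′
        (trans (sym (B-difference t i j)) (trans Bₜ≡Bₜ′ (B-difference t′ i′ j′)))

      blocks-disjoint : ∀ t t′ i j → t ≢ t′ → B t i ≢ B t′ j
      blocks-disjoint t t′ i j t≢t′ Bₜᵢ≡Bₜ′ⱼ =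
        t≢t′ (s-injective (proj₂ (b-reps.scaled-injective (s-isPower t) (s-isPower t′) Bₜᵢ≡Bₜ′ⱼ)))

      B≢0 : ∀ t i → B t i ≢ 0#
      B≢0 t i = *-≢0 (isPower⇒≢0 (s-isPower t)) (b≢0 i)

      B≢-B : ∀ t t′ i j → B t i ≢ - B t′ j
      B≢-B t t′ i j Bₜᵢ≡-Bₜ′ⱼ = s≢-s t t′ (proj₂ (b-reps.scaled-injective (s-isPower t) (-s-isPower t′)
                                                      (trans Bₜᵢ≡-Bₜ′ⱼ (-‿distribˡ-* (s t′) (b j)))))

      isBanffDifferenceFamily : IsBanffDifferenceFamily F k #S B
      isBanffDifferenceFamily =
        (blocks-injective , differences-cover , differences-unique) , blocks-disjoint , B≢0 , B≢-B

open import Data.Nat.Base using (_*_)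

mainTheorem7 : (k q : ℕ) → 3 ≤ k → IsPrimePower q → (k * (k ∸ 1)) ∣ (q ∸ 1) →
  (F : FiniteField q) →
  Σ (Fin k → FiniteField.Carrier F) (IsBanffSet F k) →
  Σ ℕ λ n → Σ (Fin n → Fin k → FiniteField.Carrier F) (IsBanffDifferenceFamily F k n)
mainTheorem7 k q 3≤k _ k[k-1]∣q-1 F
             (b , _ , differences≢0 , differences-complete , differences-distinct , b≢0 , b-distinct) =
  #S , B , isBanffDifferenceFamily
  where
  open BanffFamily F (halfPairs k) (ℕₚ.<-≤-trans (s≤s (s≤s z≤n)) 3≤k) k[k-1]∣q-1 b
    differences≢0 differences-complete differences-distinct b≢0 b-distinct
  open Family (proj₁ -1-isPower×-1≢1) (proj₂ -1-isPower×-1≢1)
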